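{- If $G$ is a graph of order $n$ with $\delta,\delta_h\ge 1$ and $n<\dfrac{\delta\,\delta_h}{\ln\delta_h+1}$, then $$\gamma_{rh}(G)\le \frac{\ln(\delta_h+1)+1}{\delta_h+1}\,n \quad\text{and}\quad \gamma_{trh}(G)\le \frac{\ln\delta_h+1}{\delta_h}\,n.$$
   Context: Graphs are finite, simple, undirected; $d(u,v)$ is distance. $\delta$ is the minimum degree of $G$, and $\delta_h$ is the minimum, over vertices $i$, of the number of vertices at distance exactly $2$ from $i$. A hop dominating set is $S\subseteq V(G)$ such that every $u\notin S$ has some $v\in S$ with $d(u,v)=2$. A 2-step dominating set is $S$ such that every vertex of $G$ has some $v\in S$ at distance $2$. A restrained hop dominating set is a hop dominating set $S$ such that every $u\notin S$ is adjacent to some $v\notin S$; a total restrained hop dominating set is a 2-step dominating set with the same property. $\gamma_{rh}(G)$, $\gamma_{trh}(G)$ are their minimum cardinalities. -}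

module Defs where

open import Data.Bool using (Bool; true; false; T)
open import Data.Nat using (ℕ; zero; suc; _≤_; _<_)
open import Data.Nat.Properties using (_!≢0)
open import Data.Nat.Base using (_!; _^_)
open import Data.Fin using (Fin; _≟_)
open import Data.Fin.Properties using (any?)
open import Data.Fin.Subset using (Subset; _∈_; _∉_; ∣_∣)
open import Data.Vec using (tabulate)
open import Data.Product using (Σ; ∃; ∃-syntax; _×_; _,_)
open import Relation.Nullary using (¬_; Dec; yes; no)
open import Relation.Nullary.Decidable using (⌊_⌋; _×-dec_; ¬?)
open import Relation.Binary.PropositionalEquality using (_≡_; _≢_)
open import Data.Bool.Properties using (T?)
import Data.Rational as ℚ
open import Data.Integer using (+_)

record Graph (n : ℕ) : Set where
  field
    adj    : Fin n → Fin n → Bool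
    sym    : ∀ i j → adj i j ≡ adj j i
    irrefl : ∀ i → adj i i ≡ false

module _ {n : ℕ} (G : Graph n) where
  open Graph G

  Adj : Fin n → Fin n → Set
  Adj i j = T (adj i j)

  Dist2 : Fin n → Fin n → Set
  Dist2 u v = u ≢ v × ¬ Adj u v × ∃[ w ] (Adj u w × Adj w v)

  dist2? : ∀ u v → Dec (Dist2 u v)
  dist2? u v = ¬? (u ≟ v) ×-dec (¬? (T? (adj u v)) ×-dec
               any? (λ w → T? (adj u w) ×-dec T? (adj w v)))

  deg : Fin n → ℕ
  deg i = ∣ tabulate (adj i) ∣

  hopDeg : Fin n → ℕ
  hopDeg i = ∣ tabulate (λ j → ⌊ dist2? i j ⌋) ∣

  IsMinOver : (Fin n → ℕ) → ℕ → Set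
  IsMinOver f m = (∀ i → m ≤ f i) × ∃[ i ] (f i ≡ m)

  IsMinDegree : ℕ → Set
  IsMinDegree = IsMinOver deg

  IsMinHopDegree : ℕ → Set
  IsMinHopDegree = IsMinOver hopDeg

  HopDominating : Subset n → Set
  HopDominating S = ∀ u → u ∉ S → ∃[ v ] (v ∈ S × Dist2 u v)

  TwoStepDominating : Subset n → Set
  TwoStepDominating S = ∀ u → ∃[ v ] (v ∈ S × Dist2 u v)

  Restrained : Subset n → Set
  Restrained S = ∀ u → u ∉ S → ∃[ v ] (v ∉ S × Adj u v)

  RestrainedHopDominating : Subset n → Set
  RestrainedHopDominating S = HopDominating S × Restrained S

  TotalRestrainedHopDominating : Subset n → Set
  TotalRestrainedHopDominating S = TwoStepDominating S × Restrained S

  IsMinCard : (Subset n → Set) → ℕ → Set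
  IsMinCard P g = (∃[ S ] (P S × ∣ S ∣ ≡ g)) × (∀ S → P S → g ≤ ∣ S ∣)

  IsGammaRH : ℕ → Set
  IsGammaRH = IsMinCard RestrainedHopDominating

  IsGammaTRH : ℕ → Set
  IsGammaTRH = IsMinCard TotalRestrainedHopDominating

-- Comparisons of e^k (k ∈ ℕ) with natural numbers, via the exponential
-- series  e^k = Σ_{j ≥ 0} k^j / j!  (partial sums increase to e^k).

expPartial : ℕ → ℕ → ℚ.ℚ
expPartial k zero    = ℚ.1ℚ
expPartial k (suc N) =
  expPartial k N ℚ.+ ((+ (k ^ suc N)) ℚ./ (suc N !)) {{suc N !≢0}}

-- e^k ≤ M
ExpLe : ℕ → ℕ → Set
ExpLe k M = ∀ N → expPartial k N ℚ.≤ (+ M) ℚ./ 1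

-- M < e^k
ExpGt : ℕ → ℕ → Set
ExpGt k M = ∃[ N ] ((+ M) ℚ./ 1 ℚ.< expPartial k N)

-- Greedy domination: if every vertex u has at least k vertices v with R u v, repeatedly choosing the
-- vertex that R-dominates the most not yet dominated vertices leaves at most n (1 − k/n)^t of them
-- after t rounds, and finishing them off one per round gives an R-dominating set S with
-- e^(k|S| − n) ≤ k^n, i.e. |S| ≤ (ln k + 1) n / k.  For R = "at distance 2" (k = δh) the hypothesis
-- on n forces |S| < δ, so every vertex keeps a neighbour outside S and S is total restrained hop
-- dominating.  For R = "equal or at distance 2" (k = δh + 1) the set obtained is restrained as well
-- when it has fewer than δ elements, and otherwise the first set is smaller than it.
-- Inequalities e^x ≤ M are handled through the partial sums of the exponential series, cleared of
-- denominators: e^X ≤ (L / (L − X))^L follows by comparison with the negative binomial series of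
-- (1 − X/L)^(−L), and for L = n (t + 1) a Bernoulli inequality bounds (L / (L − X))^L by k^n.
module Submission where

open import Defs
open import Data.Nat using (ℕ; zero; suc; _*_; _+_; _∸_; _^_; _≤_; _<_; _!; NonZero; >-nonZero; >-nonZero⁻¹; z≤n; s≤s)
open import Data.Product using (_×_; _,_; ∃-syntax; proj₁; proj₂)
open import Data.Bool using (Bool; true; false; T; if_then_else_)
open import Data.Bool.Properties using (T-≡)
open import Data.Empty using (⊥-elim)
open import Data.Fin using (Fin; zero; suc; _≟_)
open import Data.Fin.Properties using (any?)
open import Data.Fin.Subset using (Subset; Nonempty; _∈_; _∉_; _⊆_; ∣_∣; _∪_; _∩_; _─_; _-_; ⁅_⁆; ⊥; ⊤)
open import Data.Fin.Subset.Properties using (_∈?_; ∈⊤; x∈⁅x⁆; x∈p∪q⁺; x∈p∧x∉q⇒x∈p─q; ∣⁅x⁆∣≡1; ∣⊥∣≡0; ∣⊤∣≡n; ∣p∣≤n; ∣p─q∣≤∣p∣; p⊆q⇒∣p∣≤∣q∣; p⊂q⇒∣p∣<∣q∣; nonempty?; Empty-unique; p∩q≢∅⇒∣p─q∣<∣p∣; x∈p⇒∣p-x∣<∣p∣)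
import Data.Integer as ℤ
import Data.Integer.Properties as ℤ
open import Data.List using (allFin)
import Data.List.Relation.Unary.All as All
open import Data.List.Membership.Propositional.Properties using (∈-allFin)
open import Data.List.Extrema.Nat using (argmax; f[xs]≤f[argmax])
open import Data.Nat.Properties hiding (_≟_)
open import Data.Nat.Tactic.RingSolver using (solve-∀)
import Data.Rational as ℚ
import Data.Rational.Properties as ℚ
open import Data.Rational.Unnormalised as ℚᵘ using (ℚᵘ; mkℚᵘ; *≡*; *≤*)
import Data.Rational.Unnormalised.Properties as ℚᵘ
open import Data.Sum using (_⊎_; inj₁; inj₂; [_,_]′)
open import Data.Vec using ([]; _∷_; tabulate; lookup)
open import Data.Vec.Properties using (lookup∘tabulate; lookup⇒[]=; []=⇒lookup)
open import Function using (Equivalence)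
open import Relation.Binary using (Decidable)
open import Relation.Binary.PropositionalEquality
open import Relation.Nullary using (Dec; yes; no; ¬_; contradiction)
open import Relation.Nullary.Decidable using (⌊_⌋; toWitness; fromWitness; _×-dec_; _⊎-dec_; ¬?; decidable-stable)
open import Algebra.Properties.CommutativeSemigroup *-commutativeSemigroup using (x∙yz≈y∙xz; xy∙z≈y∙xz; x∙yz≈yz∙x)
open import Algebra.Properties.Semiring.Sum +-*-semiring using (sum-syntax; ∑-comm; *-distribˡ-sum; sum-cong-≗)

-- Partial sums of the exponential series

-- expPartialℕ x N = N! · expPartial x N
expPartialℕ : ℕ → ℕ → ℕ
expPartialℕ x zero    = 1
expPartialℕ x (suc N) = suc N * expPartialℕ x N + x ^ suc N

expPartialℕ-monoˡ-≤ : ∀ {x y} N → x ≤ y → expPartialℕ x N ≤ expPartialℕ y N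
expPartialℕ-monoˡ-≤ zero    x≤y = ≤-refl
expPartialℕ-monoˡ-≤ (suc N) x≤y =
  +-mono-≤ (*-monoʳ-≤ (suc N) (expPartialℕ-monoˡ-≤ N x≤y)) (^-monoˡ-≤ (suc N) x≤y)

record ExpLeℕ (x M : ℕ) : Set where
  field
    partialSums≤ : ∀ N → expPartialℕ x N ≤ M * N !
open ExpLeℕ

ExpLeℕ-antimono : ∀ {x y M} → x ≤ y → ExpLeℕ y M → ExpLeℕ x M
ExpLeℕ-antimono x≤y e^y≤M .partialSums≤ N = ≤-trans (expPartialℕ-monoˡ-≤ N x≤y) (e^y≤M .partialSums≤ N)

toℚᵘ-/ : ∀ i d .{{_ : NonZero d}} → ℚ.toℚᵘ (i ℚ./ d) ℚᵘ.≃ i ℚᵘ./ d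
toℚᵘ-/ i (suc d) = ℚ.toℚᵘ-fromℚᵘ (mkℚᵘ i d)

a/d+b/md≃[ma+b]/md : ∀ a b m d .{{_ : NonZero d}} .{{_ : NonZero (m * d)}} →
                     (ℤ.+ a) ℚᵘ./ d ℚᵘ.+ (ℤ.+ b) ℚᵘ./ (m * d) ℚᵘ.≃ (ℤ.+ (m * a + b)) ℚᵘ./ (m * d)
a/d+b/md≃[ma+b]/md a b m d@(suc _) with m * d in md≡m*d
... | md@(suc _) = *≡* (begin
  (ℤ.+ a ℤ.* ℤ.+ md ℤ.+ ℤ.+ b ℤ.* ℤ.+ d) ℤ.* ℤ.+ md
    ≡⟨ cong₂ (λ x y → (x ℤ.+ y) ℤ.* ℤ.+ md) (ℤ.pos-* a md) (ℤ.pos-* b d) ⟨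
  (ℤ.+ (a * md) ℤ.+ ℤ.+ (b * d)) ℤ.* ℤ.+ md
    ≡⟨ cong (ℤ._* ℤ.+ md) (ℤ.pos-+ (a * md) (b * d)) ⟨
  ℤ.+ (a * md + b * d) ℤ.* ℤ.+ md
    ≡⟨ ℤ.pos-* (a * md + b * d) md ⟨
  ℤ.+ ((a * md + b * d) * md)
    ≡⟨ cong (λ x → ℤ.+ ((a * x + b * d) * md)) md≡m*d ⟨
  ℤ.+ ((a * (m * d) + b * d) * md)
    ≡⟨ cong ℤ.+_ (cross-multiply a b m d md) ⟩
  ℤ.+ ((m * a + b) * (d * md))
    ≡⟨ ℤ.pos-* (m * a + b) (d * md) ⟩
  ℤ.+ (m * a + b) ℤ.* ℤ.+ (d * md) ∎)
  where
  open ≡-Reasoning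
  cross-multiply : ∀ a b m d e → (a * (m * d) + b * d) * e ≡ (m * a + b) * (d * e)
  cross-multiply = solve-∀

infixl 7 _/!_
_/!_ : ℤ.ℤ → ℕ → ℚᵘ
i /! N = (i ℚᵘ./ N !) {{N !≢0}}

toℚᵘ-expPartial : ∀ x N → ℚ.toℚᵘ (expPartial x N) ℚᵘ.≃ (ℤ.+ expPartialℕ x N) /! N
toℚᵘ-expPartial x zero    = ℚᵘ.≃-refl
toℚᵘ-expPartial x (suc N) = begin
  ℚ.toℚᵘ (expPartial x N ℚ.+ ((ℤ.+ (x ^ suc N)) ℚ./ suc N !) {{suc N !≢0}})
    ≈⟨ ℚ.toℚᵘ-homo-+ (expPartial x N) _ ⟩
  ℚ.toℚᵘ (expPartial x N) ℚᵘ.+ ℚ.toℚᵘ (((ℤ.+ (x ^ suc N)) ℚ./ suc N !) {{suc N !≢0}})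
    ≈⟨ ℚᵘ.+-cong (toℚᵘ-expPartial x N) (toℚᵘ-/ (ℤ.+ (x ^ suc N)) (suc N !) {{suc N !≢0}}) ⟩
  (ℤ.+ expPartialℕ x N) /! N ℚᵘ.+ (ℤ.+ (x ^ suc N)) /! suc N
    ≈⟨ a/d+b/md≃[ma+b]/md (expPartialℕ x N) (x ^ suc N) (suc N) (N !) {{N !≢0}} {{suc N !≢0}} ⟩
  (ℤ.+ expPartialℕ x (suc N)) /! suc N ∎
  where open ℚᵘ.≃-Reasoning

a/d≤b/1 : ∀ {a b} d .{{_ : NonZero d}} → a ≤ b * d → (ℤ.+ a) ℚᵘ./ d ℚᵘ.≤ (ℤ.+ b) ℚᵘ./ 1
a/d≤b/1 {a} {b} d@(suc _) a≤b*d =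
  *≤* (subst₂ ℤ._≤_ (sym (ℤ.*-identityʳ (ℤ.+ a))) (ℤ.pos-* b d) (ℤ.+≤+ a≤b*d))

ExpLeℕ⇒ExpLe : ∀ {x M} → ExpLeℕ x M → ExpLe x M
ExpLeℕ⇒ExpLe {x} {M} e^x≤M N = ℚ.toℚᵘ-cancel-≤ (begin
  ℚ.toℚᵘ (expPartial x N)     ≃⟨ toℚᵘ-expPartial x N ⟩
  (ℤ.+ expPartialℕ x N) /! N  ≤⟨ a/d≤b/1 (N !) {{N !≢0}} (e^x≤M .partialSums≤ N) ⟩
  (ℤ.+ M) ℚᵘ./ 1              ≃⟨ toℚᵘ-/ (ℤ.+ M) 1 ⟨
  ℚ.toℚᵘ ((ℤ.+ M) ℚ./ 1)      ∎)
  where open ℚᵘ.≤-Reasoning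

ExpGt⇒¬ExpLe : ∀ x M → ExpGt x M → ¬ ExpLe x M
ExpGt⇒¬ExpLe x M (N , M<e^x) e^x≤M = ℚ.<-irrefl refl (ℚ.<-≤-trans M<e^x (e^x≤M N))

-- The bound e^X ≤ (L / (L − X))^L

rising : ℕ → ℕ → ℕ
rising L zero    = 1
rising L (suc j) = rising L j * (L + j)

rising-zero : ∀ j → rising 0 (suc j) ≡ 0
rising-zero zero    = refl
rising-zero (suc j) = cong (_* suc j) (rising-zero j)

^≤rising : ∀ L j → L ^ j ≤ rising L j
^≤rising L zero    = ≤-refl
^≤rising L (suc j) = begin
  L * L ^ j            ≡⟨ *-comm L (L ^ j) ⟩
  L ^ j * L            ≤⟨ *-mono-≤ (^≤rising L j) (m≤m+n L j) ⟩
  rising L j * (L + j) ∎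
  where open ≤-Reasoning

*-rising-suc : ∀ L j → L * rising (suc L) j ≡ rising L (suc j)
*-rising-suc L zero    = trans (*-identityʳ L) (sym (trans (*-identityˡ _) (+-identityʳ L)))
*-rising-suc L (suc j) = begin
  L * (rising (suc L) j * (suc L + j)) ≡⟨ *-assoc L _ _ ⟨
  L * rising (suc L) j * (suc L + j)   ≡⟨ cong₂ _*_ (*-rising-suc L j) (sym (+-suc L j)) ⟩
  rising L (suc j) * (L + suc j)       ∎
  where open ≡-Reasoning

rising-pascal : ∀ L j → rising (suc L) (suc j) ≡ rising L (suc j) + suc j * rising (suc L) j
rising-pascal L j = begin
  rising (suc L) j * (suc L + j)                  ≡⟨ split-factor (rising (suc L) j) L j ⟩
  L * rising (suc L) j + suc j * rising (suc L) j ≡⟨ cong (_+ suc j * rising (suc L) j) (*-rising-suc L j) ⟩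
  rising L (suc j) + suc j * rising (suc L) j     ∎
  where
  open ≡-Reasoning
  split-factor : ∀ r L j → r * (suc L + j) ≡ L * r + suc j * r
  split-factor = solve-∀

module NegativeBinomial (m X : ℕ) where

  -- series L N = N! m^N Σ_{j ≤ N} (rising L j / j!) (X/m)^j, a partial sum of (1 − X/m)^(−L)
  series : ℕ → ℕ → ℕ
  series L zero    = 1
  series L (suc N) = suc N * m * series L N + rising L (suc N) * X ^ suc N

  series-pascal : ∀ L N → series (suc L) (suc N) ≡ series L (suc N) + X * suc N * series (suc L) N
  series-pascal L zero    = first-terms m X L
    where
    first-terms : ∀ m X L → 1 * m * 1 + 1 * (suc L + 0) * (X * 1) ≡ 1 * m * 1 + 1 * (L + 0) * (X * 1) + X * 1 * 1
    first-terms = solve-∀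
  series-pascal L (suc N) = begin
    suc (suc N) * m * series (suc L) (suc N) + rising (suc L) (suc (suc N)) * X ^ suc (suc N)
      ≡⟨ cong₂ (λ s r → suc (suc N) * m * s + r * X ^ suc (suc N)) (series-pascal L N) (rising-pascal L (suc N)) ⟩
    suc (suc N) * m * (series L (suc N) + X * suc N * series (suc L) N)
      + (rising L (suc (suc N)) + suc (suc N) * rising (suc L) (suc N)) * X ^ suc (suc N)
      ≡⟨ regroup (suc N) m (series L (suc N)) X (series (suc L) N) (rising L (suc (suc N))) (rising (suc L) (suc N)) (X ^ suc N) ⟩
    series L (suc (suc N)) + X * suc (suc N) * series (suc L) (suc N) ∎
    where
    open ≡-Reasoning
    regroup : ∀ n m s X s′ r r′ p → suc n * m * (s + X * n * s′) + (r + suc n * r′) * (X * p)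
                                  ≡ suc n * m * s + r * (X * p) + X * suc n * (n * m * s′ + r′ * p)
    regroup = solve-∀

  series-zero : ∀ N → series 0 N ≡ N ! * m ^ N
  series-zero zero    = refl
  series-zero (suc N) = begin
    suc N * m * series 0 N + rising 0 (suc N) * X ^ suc N
      ≡⟨ cong₂ (λ s r → suc N * m * s + r * X ^ suc N) (series-zero N) (rising-zero N) ⟩
    suc N * m * (N ! * m ^ N) + 0 ≡⟨ regroup (suc N) m (N !) (m ^ N) ⟩
    suc N * N ! * (m * m ^ N)     ∎
    where
    open ≡-Reasoning
    regroup : ∀ a m f p → a * m * (f * p) + 0 ≡ a * f * (m * p)
    regroup = solve-∀

  series-step : X ≤ m → ∀ L N → (m ∸ X) * series (suc L) N ≤ m * series L N
  series-step X≤m L zero    = *-monoˡ-≤ 1 (m∸n≤m m X)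
  series-step X≤m L (suc N) = +-cancelʳ-≤ (X * s) _ _ (begin
    (m ∸ X) * s + X * s                                       ≡⟨ *-distribʳ-+ s (m ∸ X) X ⟨
    (m ∸ X + X) * s                                           ≡⟨ cong (_* s) (m∸n+n≡m X≤m) ⟩
    m * s                                                     ≡⟨ cong (m *_) (series-pascal L N) ⟩
    m * (series L (suc N) + X * suc N * series (suc L) N)     ≡⟨ regroup m (series L (suc N)) X (suc N) (series (suc L) N) ⟩
    m * series L (suc N) + X * (suc N * m * series (suc L) N) ≤⟨ +-monoʳ-≤ (m * series L (suc N)) (*-monoʳ-≤ X (m≤m+n _ _)) ⟩
    m * series L (suc N) + X * s                              ∎)
    where
    s = series (suc L) (suc N)
    open ≤-Reasoning
    regroup : ∀ m s X n s′ → m * (s + X * n * s′) ≡ m * s + X * (n * m * s′)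
    regroup = solve-∀

  series-bound : X ≤ m → ∀ L N → (m ∸ X) ^ L * series L N ≤ m ^ L * (N ! * m ^ N)
  series-bound X≤m zero    N = ≤-reflexive (trans (*-identityˡ _) (trans (series-zero N) (sym (*-identityˡ _))))
  series-bound X≤m (suc L) N = begin
    (m ∸ X) * (m ∸ X) ^ L * series (suc L) N   ≡⟨ xy∙z≈y∙xz (m ∸ X) ((m ∸ X) ^ L) (series (suc L) N) ⟩
    (m ∸ X) ^ L * ((m ∸ X) * series (suc L) N) ≤⟨ *-monoʳ-≤ ((m ∸ X) ^ L) (series-step X≤m L N) ⟩
    (m ∸ X) ^ L * (m * series L N)             ≡⟨ x∙yz≈y∙xz ((m ∸ X) ^ L) m (series L N) ⟩
    m * ((m ∸ X) ^ L * series L N)             ≤⟨ *-monoʳ-≤ m (series-bound X≤m L N) ⟩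
    m * (m ^ L * (N ! * m ^ N))                ≡⟨ *-assoc m _ _ ⟨
    m * m ^ L * (N ! * m ^ N)                  ∎
    where open ≤-Reasoning

  expPartialℕ-≤-series : ∀ N → expPartialℕ X N * m ^ N ≤ series m N
  expPartialℕ-≤-series zero    = ≤-refl
  expPartialℕ-≤-series (suc N) = begin
    (suc N * expPartialℕ X N + X ^ suc N) * (m * m ^ N)
      ≡⟨ expand (suc N) (expPartialℕ X N) (X ^ suc N) m (m ^ N) ⟩
    suc N * m * (expPartialℕ X N * m ^ N) + m * m ^ N * X ^ suc N
      ≤⟨ +-mono-≤ (*-monoʳ-≤ (suc N * m) (expPartialℕ-≤-series N)) (*-monoˡ-≤ (X ^ suc N) (^≤rising m (suc N))) ⟩
    suc N * m * series m N + rising m (suc N) * X ^ suc N ∎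
    where
    open ≤-Reasoning
    expand : ∀ n e p m q → (n * e + p) * (m * q) ≡ n * m * (e * q) + m * q * p
    expand = solve-∀

ExpLeℕ-from-pow : ∀ {X Y L M} → X + Y ≡ L → 1 ≤ Y → L ^ L ≤ M * Y ^ L → ExpLeℕ X M
ExpLeℕ-from-pow {X} {Y} {L} {M} refl 1≤Y L^L≤M*Y^L .partialSums≤ N =
  *-cancelˡ-≤ (L ^ N) (*-cancelˡ-≤ (Y ^ L) (begin
    Y ^ L * (L ^ N * expPartialℕ X N)       ≡⟨ cong (λ y → y ^ L * (L ^ N * expPartialℕ X N)) (m+n∸m≡n X Y) ⟨
    (L ∸ X) ^ L * (L ^ N * expPartialℕ X N) ≡⟨ cong ((L ∸ X) ^ L *_) (*-comm (L ^ N) _) ⟩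
    (L ∸ X) ^ L * (expPartialℕ X N * L ^ N) ≤⟨ *-monoʳ-≤ ((L ∸ X) ^ L) (expPartialℕ-≤-series N) ⟩
    (L ∸ X) ^ L * series L N                ≤⟨ series-bound (m≤m+n X Y) L N ⟩
    L ^ L * (N ! * L ^ N)                   ≤⟨ *-monoˡ-≤ (N ! * L ^ N) L^L≤M*Y^L ⟩
    M * Y ^ L * (N ! * L ^ N)               ≡⟨ regroup M (Y ^ L) (N !) (L ^ N) ⟩
    Y ^ L * (L ^ N * (M * N !))             ∎))
  where
  open NegativeBinomial L X
  open ≤-Reasoning
  instance
    _ : NonZero Y
    _ = >-nonZero 1≤Y
    _ : NonZero L
    _ = >-nonZero (≤-trans 1≤Y (m≤n+m Y X))
    _ : NonZero (Y ^ L)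
    _ = m^n≢0 Y L
    _ : NonZero (L ^ N)
    _ = m^n≢0 L N
  regroup : ∀ a b c d → a * b * (c * d) ≡ b * (d * (a * c))
  regroup = solve-∀

-- The number of greedy rounds

^-distribʳ-* : ∀ m n o → (m * n) ^ o ≡ m ^ o * n ^ o
^-distribʳ-* m n zero    = refl
^-distribʳ-* m n (suc o) = trans (cong (m * n *_) (^-distribʳ-* m n o)) (interchange m n (m ^ o) (n ^ o))
  where
  interchange : ∀ a b x y → a * b * (x * y) ≡ a * x * (b * y)
  interchange = solve-∀

bernoulli : ∀ a e s → a ^ suc s + suc s * a ^ s * e ≤ (a + e) ^ suc s
bernoulli a e zero    = ≤-reflexive (base a e)
  where
  base : ∀ a e → a * 1 + 1 * 1 * e ≡ (a + e) * 1
  base = solve-∀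
bernoulli a e (suc s) = begin
  a * (a * a ^ s) + suc (suc s) * (a * a ^ s) * e                         ≤⟨ m≤m+n _ _ ⟩
  a * (a * a ^ s) + suc (suc s) * (a * a ^ s) * e + suc s * a ^ s * e * e ≡⟨ factor a (a ^ s) e s ⟩
  (a + e) * (a * a ^ s + suc s * a ^ s * e)                               ≤⟨ *-monoʳ-≤ (a + e) (bernoulli a e s) ⟩
  (a + e) * (a + e) ^ suc s                                               ∎
  where
  open ≤-Reasoning
  factor : ∀ a p e s → a * (a * p) + suc (suc s) * (a * p) * e + suc s * p * e * e
                     ≡ (a + e) * (a * p + suc s * p * e)
  factor = solve-∀

^-mono-ratio : ∀ {a b} k t n → a ^ t ≤ k * b ^ t → a ^ (t * n) ≤ k ^ n * b ^ (t * n)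
^-mono-ratio {a} {b} k t n a^t≤kb^t = begin
  a ^ (t * n)         ≡⟨ ^-*-assoc a t n ⟨
  (a ^ t) ^ n         ≤⟨ ^-monoˡ-≤ n a^t≤kb^t ⟩
  (k * b ^ t) ^ n     ≡⟨ ^-distribʳ-* k (b ^ t) n ⟩
  k ^ n * (b ^ t) ^ n ≡⟨ cong (k ^ n *_) (^-*-assoc b t n) ⟩
  k ^ n * b ^ (t * n) ∎
  where open ≤-Reasoning

[nt]^t≤k[sc+d]^t : ∀ {k c s d} → c ≤ d → (k + c) ^ suc s ≤ k * c ^ s * d →
                   ((k + c) * suc s) ^ suc s ≤ k * (s * c + d) ^ suc s
[nt]^t≤k[sc+d]^t {k} {c} {s} {d} c≤d n^t≤kc^sd = begin
  (n * t) ^ t                   ≡⟨ ^-distribʳ-* n t t ⟩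
  n ^ t * t ^ t                 ≤⟨ *-monoˡ-≤ (t ^ t) n^t≤kc^sd ⟩
  k * c ^ s * d * (t * t ^ s)   ≡⟨ regroup k (c ^ s) d t (t ^ s) ⟩
  k * (t * (t ^ s * c ^ s) * d) ≡⟨ cong₂ (λ p q → k * (t * p * q)) (^-distribʳ-* t c s) c+e≡d ⟨
  k * (t * a ^ s * (c + e))     ≡⟨ cong (k *_) (distribute t c (a ^ s) e) ⟩
  k * (a ^ t + t * a ^ s * e)   ≤⟨ *-monoʳ-≤ k (bernoulli a e s) ⟩
  k * (a + e) ^ t               ≡⟨ cong (λ y → k * y ^ t) (trans (unfold s c e) (cong ((s * c) +_) c+e≡d)) ⟩
  k * (s * c + d) ^ t           ∎
  where
  n = k + c
  t = suc s
  e = d ∸ c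
  a = t * c
  c+e≡d : c + e ≡ d
  c+e≡d = m+[n∸m]≡n c≤d
  open ≤-Reasoning
  regroup : ∀ k p d t q → k * p * d * (t * q) ≡ k * (t * (q * p) * d)
  regroup = solve-∀
  distribute : ∀ t c q e → t * q * (c + e) ≡ t * c * q + t * q * e
  distribute = solve-∀
  unfold : ∀ s c e → suc s * c + e ≡ s * c + (c + e)
  unfold = solve-∀

-- e^X ≤ (L/Y)^L ≤ k^(k + c) for L = (k + c)(s + 1) and Y = s c + d
ExpLeℕ-via-bernoulli : ∀ {k c s Z d} → 1 ≤ k → Z + d ≡ k + c → c ≤ d →
                       (k + c) ^ suc s ≤ k * c ^ s * d → ExpLeℕ (k * s + Z) (k ^ (k + c))
ExpLeℕ-via-bernoulli {k} {c} {s} {Z} {d} 1≤k Z+d≡n c≤d n^t≤kc^sd = ExpLeℕ-from-pow X+Y≡L 1≤Y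
  (subst (λ m → L ^ m ≤ k ^ n * Y ^ m) (*-comm t n) (^-mono-ratio k t n ([nt]^t≤k[sc+d]^t {k} c≤d n^t≤kc^sd)))
  where
  n = k + c
  t = suc s
  L = n * t
  Y = s * c + d

  X+Y≡L : k * s + Z + Y ≡ L
  X+Y≡L = begin
    k * s + Z + (s * c + d) ≡⟨ regroup k s Z c d ⟩
    n * s + (Z + d)         ≡⟨ cong ((n * s) +_) Z+d≡n ⟩
    n * s + n               ≡⟨ trans (+-comm (n * s) n) (sym (*-suc n s)) ⟩
    n * t                   ∎
    where
    open ≡-Reasoning
    regroup : ∀ k s Z c d → k * s + Z + (s * c + d) ≡ (k + c) * s + (Z + d)
    regroup = solve-∀

  1≤Y : 1 ≤ Y
  1≤Y = ≤-trans (>-nonZero⁻¹ d) (m≤n+m d (s * c))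
    where
    instance
      _ : NonZero n
      _ = >-nonZero (≤-trans 1≤k (m≤m+n k c))
      _ : NonZero (k * c ^ s * d)
      _ = >-nonZero (≤-trans (m^n>0 n t) n^t≤kc^sd)
      _ : NonZero d
      _ = m*n≢0⇒n≢0 (k * c ^ s)

-- (P − Q)(n Q − c P) ≥ 0, expanded
nQQ+cPP≤PQ[n+c] : ∀ n c {P Q} → Q ≤ P → c * P ≤ n * Q → n * Q * Q + c * P * P ≤ P * Q * (n + c)
nQQ+cPP≤PQ[n+c] n c {Q = Q} Q≤P cP≤nQ with record { quotient = e ; equality = refl } ← ≤⇒≤″ Q≤P = begin
  n * Q * Q + c * (Q + e) * (Q + e)               ≡⟨ expand n c Q e ⟩
  n * Q * Q + c * (Q + e) * Q + e * (c * (Q + e)) ≤⟨ +-monoʳ-≤ (n * Q * Q + c * (Q + e) * Q) (*-monoʳ-≤ e cP≤nQ) ⟩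
  n * Q * Q + c * (Q + e) * Q + e * (n * Q)       ≡⟨ factor n c Q e ⟩
  (Q + e) * Q * (n + c)                           ∎
  where
  open ≤-Reasoning
  expand : ∀ n c Q e → n * Q * Q + c * (Q + e) * (Q + e) ≡ n * Q * Q + c * (Q + e) * Q + e * (c * (Q + e))
  expand = solve-∀
  factor : ∀ n c Q e → n * Q * Q + c * (Q + e) * Q + e * (n * Q) ≡ (Q + e) * Q * (n + c)
  factor = solve-∀

n*Q≤P*d : ∀ n c k r {d P Q} → 1 ≤ Q → Q ≤ P → c * P ≤ n * Q → k * (Q * r) ≤ c * P →
          n + c ≤ d + k * r → n * Q ≤ P * d
n*Q≤P*d n c k r {d} {P} {Q} 1≤Q Q≤P cP≤nQ kQr≤cP n+c≤d+kr =
  *-cancelʳ-≤ (n * Q) (P * d) Q {{>-nonZero 1≤Q}} (+-cancelʳ-≤ (c * P * P) _ _ (begin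
    n * Q * Q + c * P * P         ≤⟨ nQQ+cPP≤PQ[n+c] n c Q≤P cP≤nQ ⟩
    P * Q * (n + c)               ≤⟨ *-monoʳ-≤ (P * Q) n+c≤d+kr ⟩
    P * Q * (d + k * r)           ≡⟨ expand P Q d k r ⟩
    P * d * Q + P * (k * (Q * r)) ≤⟨ +-monoʳ-≤ (P * d * Q) (*-monoʳ-≤ P kQr≤cP) ⟩
    P * d * Q + P * (c * P)       ≡⟨ cong ((P * d * Q) +_) (x∙yz≈yz∙x P c P) ⟩
    P * d * Q + c * P * P         ∎))
  where
  open ≤-Reasoning
  expand : ∀ P Q d k r → P * Q * (d + k * r) ≡ P * d * Q + P * (k * (Q * r))
  expand = solve-∀

k[1+s+r]≡ks+[k+kr] : ∀ k s r → k * (suc s + r) ≡ k * s + (k + k * r)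
k[1+s+r]≡ks+[k+kr] = solve-∀

k[1+s+r]∸n≤ks : ∀ k s r {n} → k + k * r ≤ n → k * (suc s + r) ∸ n ≤ k * s
k[1+s+r]∸n≤ks k s r {n} k+kr≤n = begin
  k * (suc s + r) ∸ n     ≡⟨ cong (_∸ n) (k[1+s+r]≡ks+[k+kr] k s r) ⟩
  k * s + (k + k * r) ∸ n ≤⟨ ∸-monoˡ-≤ n (+-monoʳ-≤ (k * s) k+kr≤n) ⟩
  k * s + n ∸ n           ≡⟨ m+n∸n≡m (k * s) n ⟩
  k * s                   ∎
  where open ≤-Reasoning

k[1+s+r]∸n≡ks+Z : ∀ k s r {n Z} → n + Z ≡ k + k * r → k * (suc s + r) ∸ n ≡ k * s + Z
k[1+s+r]∸n≡ks+Z k s r {n} {Z} n+Z≡k+kr = begin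
  k * (suc s + r) ∸ n     ≡⟨ cong (_∸ n) (k[1+s+r]≡ks+[k+kr] k s r) ⟩
  k * s + (k + k * r) ∸ n ≡⟨ cong (λ m → k * s + m ∸ n) n+Z≡k+kr ⟨
  k * s + (n + Z) ∸ n     ≡⟨ cong (_∸ n) (regroup (k * s) n Z) ⟩
  k * s + Z + n ∸ n       ≡⟨ m+n∸n≡m (k * s + Z) n ⟩
  k * s + Z               ∎
  where
  open ≡-Reasoning
  regroup : ∀ a n Z → a + (n + Z) ≡ a + Z + n
  regroup = solve-∀

excess-split : ∀ k c r → k * r ≤ k + c → k + c ≤ k + k * r →
               ∃[ Z ] ∃[ d ] (k + c + Z ≡ k + k * r × Z + d ≡ k + c × c ≤ d × k + c + c ≡ d + k * r)
excess-split k c r kr≤n n≤k+kr = Z , d , n+Z≡k+kr , Z+d≡n , c≤d , n+c≡d+kr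
  where
  n = k + c
  Z = k + k * r ∸ n
  d = n ∸ Z
  n+Z≡k+kr : n + Z ≡ k + k * r
  n+Z≡k+kr = m+[n∸m]≡n n≤k+kr
  Z≤k : Z ≤ k
  Z≤k = +-cancelˡ-≤ n Z k (begin
    n + Z     ≡⟨ n+Z≡k+kr ⟩
    k + k * r ≤⟨ +-monoʳ-≤ k kr≤n ⟩
    k + n     ≡⟨ +-comm k n ⟩
    n + k     ∎)
    where open ≤-Reasoning
  Z+d≡n : Z + d ≡ n
  Z+d≡n = m+[n∸m]≡n (≤-trans Z≤k (m≤m+n k c))
  c≤d : c ≤ d
  c≤d = +-cancelˡ-≤ Z c d (≤-trans (+-monoˡ-≤ c Z≤k) (≤-reflexive (sym Z+d≡n)))
  n+c≡d+kr : n + c ≡ d + k * r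
  n+c≡d+kr = +-cancelʳ-≡ k _ _ (begin
    n + c + k       ≡⟨ regroup₁ k c ⟩
    n + n           ≡⟨ cong (n +_) Z+d≡n ⟨
    n + (Z + d)     ≡⟨ regroup₂ n Z d ⟩
    d + (n + Z)     ≡⟨ cong (d +_) n+Z≡k+kr ⟩
    d + (k + k * r) ≡⟨ regroup₃ d k (k * r) ⟩
    d + k * r + k   ∎)
    where
    open ≡-Reasoning
    regroup₁ : ∀ k c → k + c + c + k ≡ k + c + (k + c)
    regroup₁ = solve-∀
    regroup₂ : ∀ n Z d → n + (Z + d) ≡ d + (n + Z)
    regroup₂ = solve-∀
    regroup₃ : ∀ d k x → d + (k + x) ≡ d + x + k
    regroup₃ = solve-∀

-- The hypotheses say (1 − k/n)^s > 1/k ≥ (1 − k/n)^(s+1) for n = k + c, so after s + 1 rounds k r ≤ n.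
ExpLeℕ-after-rounds : ∀ {k c s r} → 1 ≤ k → (k + c) ^ s < k * c ^ s → k * c ^ suc s ≤ (k + c) ^ suc s →
                      (k + c) ^ suc s * r ≤ (k + c) * c ^ suc s →
                      ExpLeℕ (k * (suc s + r) ∸ (k + c)) (k ^ (k + c))
ExpLeℕ-after-rounds {k} {c} {s} {r} 1≤k Q<P kc^[1+s]≤n^[1+s] n^[1+s]r≤nc^[1+s] =
  [ few-left , many-left ]′ (≤-total (k + k * r) n)
  where
  n = k + c
  Q = n ^ s
  P = k * c ^ s
  X = k * (suc s + r) ∸ n
  instance
    _ : NonZero n
    _ = >-nonZero (≤-trans 1≤k (m≤m+n k c))
    _ : NonZero Q
    _ = m^n≢0 n s

  cP≤nQ : c * P ≤ n * Q
  cP≤nQ = subst (_≤ n * Q) (x∙yz≈y∙xz k c (c ^ s)) kc^[1+s]≤n^[1+s]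

  kQr≤cP : k * (Q * r) ≤ c * P
  kQr≤cP = subst (k * (Q * r) ≤_) (x∙yz≈y∙xz k c (c ^ s))
    (*-monoʳ-≤ k (*-cancelˡ-≤ n (subst (_≤ n * c ^ suc s) (*-assoc n Q r) n^[1+s]r≤nc^[1+s])))

  kr≤n : k * r ≤ n
  kr≤n = *-cancelˡ-≤ Q (begin
    Q * (k * r) ≡⟨ x∙yz≈y∙xz Q k r ⟩
    k * (Q * r) ≤⟨ kQr≤cP ⟩
    c * P       ≤⟨ cP≤nQ ⟩
    n * Q       ≡⟨ *-comm n Q ⟩
    Q * n       ∎)
    where open ≤-Reasoning

  few-left : k + k * r ≤ n → ExpLeℕ X (k ^ n)
  few-left k+kr≤n = ExpLeℕ-antimono (≤-trans (k[1+s+r]∸n≤ks k s r k+kr≤n) (≤-reflexive (sym (+-identityʳ (k * s)))))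
    (ExpLeℕ-via-bernoulli {Z = 0} 1≤k refl (m≤n+m c k) (subst (n * Q ≤_) (*-comm n P) (*-monoʳ-≤ n (<⇒≤ Q<P))))

  many-left : n ≤ k + k * r → ExpLeℕ X (k ^ n)
  many-left n≤k+kr with Z , d , n+Z≡k+kr , Z+d≡n , c≤d , n+c≡d+kr ← excess-split k c r kr≤n n≤k+kr =
    ExpLeℕ-antimono (≤-reflexive (k[1+s+r]∸n≡ks+Z k s r n+Z≡k+kr)) (ExpLeℕ-via-bernoulli 1≤k Z+d≡n c≤d
      (n*Q≤P*d n c k r (m^n>0 n s) (<⇒≤ Q<P) cP≤nQ kQr≤cP (≤-reflexive n+c≡d+kr)))

crossing : ∀ {P : ℕ → Set} → (∀ s → Dec (P s)) → P 0 → ∀ {B} → ¬ P B → ∃[ s ] (P s × ¬ P (suc s))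
crossing P? P0 {zero}  ¬P0     = contradiction P0 ¬P0
crossing P? P0 {suc B} ¬P[1+B] with P? B
... | yes PB = B , PB , ¬P[1+B]
... | no ¬PB = crossing P? P0 ¬PB

k*c^[1+c]≤[k+c]^[1+c] : ∀ k c → k * c ^ suc c ≤ (k + c) ^ suc c
k*c^[1+c]≤[k+c]^[1+c] k c = begin
  k * (c * c ^ c)               ≡⟨ *-comm k (c * c ^ c) ⟩
  c * c ^ c * k                 ≤⟨ *-monoˡ-≤ k (*-monoˡ-≤ (c ^ c) (n≤1+n c)) ⟩
  suc c * c ^ c * k             ≤⟨ m≤n+m _ (c ^ suc c) ⟩
  c ^ suc c + suc c * c ^ c * k ≤⟨ bernoulli c k c ⟩
  (c + k) ^ suc c               ≡⟨ cong (_^ suc c) (+-comm c k) ⟩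
  (k + c) ^ suc c               ∎
  where open ≤-Reasoning

∃-rounds-k+c : ∀ k c → 1 ≤ k → ∃[ t ] ∀ r → (k + c) ^ t * r ≤ (k + c) * c ^ t →
               ExpLeℕ (k * (t + r) ∸ (k + c)) (k ^ (k + c))
∃-rounds-k+c 1 c _ = 0 , λ r r≤n → ExpLeℕ-antimono
  (≤-reflexive (m≤n⇒m∸n≡0 (subst (1 * r ≤_) (*-identityʳ (1 + c)) r≤n)))
  (ExpLeℕ-from-pow {0} {1} refl ≤-refl (≤-reflexive (sym (trans (*-identityʳ _) (^-zeroˡ (1 + c))))))
∃-rounds-k+c k@(suc (suc _)) c _
  with s , Q<P , P≮Q ← crossing (λ s → (k + c) ^ s <? k * c ^ s) (subst (1 <_) (sym (*-identityʳ k)) (s≤s (s≤s z≤n)))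
                                {suc c} (≤⇒≯ (k*c^[1+c]≤[k+c]^[1+c] k c))
  = suc s , λ r → ExpLeℕ-after-rounds {k} {c} {s} {r} (s≤s z≤n) Q<P (≮⇒≥ P≮Q)

∃-rounds : ∀ n k → 1 ≤ k → k ≤ n → ∃[ t ] ∀ r → n ^ t * r ≤ n * (n ∸ k) ^ t → ExpLeℕ (k * (t + r) ∸ n) (k ^ n)
∃-rounds n k 1≤k k≤n with record { quotient = c ; equality = refl } ← ≤⇒≤″ k≤n
  rewrite m+n∸m≡n k c = ∃-rounds-k+c k c 1≤k

-- Counting subsets

χ : ∀ {n} → Subset n → Fin n → ℕ
χ p i = if lookup p i then 1 else 0

∣p∣≡∑χ : ∀ {n} (p : Subset n) → ∣ p ∣ ≡ ∑[ i < n ] χ p i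
∣p∣≡∑χ []          = refl
∣p∣≡∑χ (true  ∷ p) = cong suc (∣p∣≡∑χ p)
∣p∣≡∑χ (false ∷ p) = ∣p∣≡∑χ p

χ-∩ : ∀ {n} (p q : Subset n) i → χ (p ∩ q) i ≡ χ p i * χ q i
χ-∩ (true  ∷ p) (true  ∷ q) zero    = refl
χ-∩ (true  ∷ p) (false ∷ q) zero    = refl
χ-∩ (false ∷ p) (y     ∷ q) zero    = refl
χ-∩ (x     ∷ p) (y     ∷ q) (suc i) = χ-∩ p q i

∣p∣≡∣p─q∣+∣p∩q∣ : ∀ {n} (p q : Subset n) → ∣ p ∣ ≡ ∣ p ─ q ∣ + ∣ p ∩ q ∣
∣p∣≡∣p─q∣+∣p∩q∣ []          []          = refl
∣p∣≡∣p─q∣+∣p∩q∣ (true  ∷ p) (true  ∷ q) = trans (cong suc (∣p∣≡∣p─q∣+∣p∩q∣ p q)) (sym (+-suc _ _))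
∣p∣≡∣p─q∣+∣p∩q∣ (true  ∷ p) (false ∷ q) = cong suc (∣p∣≡∣p─q∣+∣p∩q∣ p q)
∣p∣≡∣p─q∣+∣p∩q∣ (false ∷ p) (true  ∷ q) = ∣p∣≡∣p─q∣+∣p∩q∣ p q
∣p∣≡∣p─q∣+∣p∩q∣ (false ∷ p) (false ∷ q) = ∣p∣≡∣p─q∣+∣p∩q∣ p q

∣p∪q∣≤∣p∣+∣q∣ : ∀ {n} (p q : Subset n) → ∣ p ∪ q ∣ ≤ ∣ p ∣ + ∣ q ∣
∣p∪q∣≤∣p∣+∣q∣ []          []          = z≤n
∣p∪q∣≤∣p∣+∣q∣ (true  ∷ p) (true  ∷ q) = s≤s (≤-trans (∣p∪q∣≤∣p∣+∣q∣ p q) (+-monoʳ-≤ ∣ p ∣ (n≤1+n ∣ q ∣)))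
∣p∪q∣≤∣p∣+∣q∣ (true  ∷ p) (false ∷ q) = s≤s (∣p∪q∣≤∣p∣+∣q∣ p q)
∣p∪q∣≤∣p∣+∣q∣ (false ∷ p) (true  ∷ q) = ≤-trans (s≤s (∣p∪q∣≤∣p∣+∣q∣ p q)) (≤-reflexive (sym (+-suc _ _)))
∣p∪q∣≤∣p∣+∣q∣ (false ∷ p) (false ∷ q) = ∣p∪q∣≤∣p∣+∣q∣ p q

∑-mono-≤ : ∀ {n} {f g : Fin n → ℕ} → (∀ i → f i ≤ g i) → ∑[ i < n ] f i ≤ ∑[ i < n ] g i
∑-mono-≤ {zero}  f≤g = z≤n
∑-mono-≤ {suc n} f≤g = +-mono-≤ (f≤g zero) (∑-mono-≤ (λ i → f≤g (suc i)))

∑≤n*max : ∀ {n m} {f : Fin n → ℕ} → (∀ i → f i ≤ m) → ∑[ i < n ] f i ≤ n * m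
∑≤n*max {zero}  f≤m = z≤n
∑≤n*max {suc n} f≤m = +-mono-≤ (f≤m zero) (∑≤n*max (λ i → f≤m (suc i)))

averaging : ∀ {n} .{{_ : NonZero n}} (f : Fin n → ℕ) → ∃[ v ] (∑[ i < n ] f i ≤ n * f v)
averaging {suc n} f = argmax f zero (allFin (suc n)) ,
  ∑≤n*max (λ i → All.lookup (f[xs]≤f[argmax] {f = f} zero (allFin (suc n))) (∈-allFin i))

∈-tabulate⁺ : ∀ {n} {f : Fin n → Bool} {i} → T (f i) → i ∈ tabulate f
∈-tabulate⁺ {f = f} {i} fi = lookup⇒[]= i (tabulate f) (trans (lookup∘tabulate f i) (Equivalence.to T-≡ fi))

∈-tabulate⁻ : ∀ {n} {f : Fin n → Bool} {i} → i ∈ tabulate f → T (f i)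
∈-tabulate⁻ {f = f} {i} i∈f = Equivalence.from T-≡ (trans (sym (lookup∘tabulate f i)) ([]=⇒lookup i∈f))

k≤∣f∣⇒k≤n : ∀ {n} .{{_ : NonZero n}} {k} (f : Fin n → Subset n) → (∀ u → k ≤ ∣ f u ∣) → k ≤ n
k≤∣f∣⇒k≤n {suc n} f k≤∣f∣ = ≤-trans (k≤∣f∣ zero) (∣p∣≤n (f zero))

-- Greedy domination

Dominating : ∀ {n} → (Fin n → Fin n → Set) → Subset n → Set
Dominating R S = ∀ u → ∃[ v ] (v ∈ S × R u v)

module _ {n} {R : Fin n → Fin n → Set} (R? : Decidable R) where

  image : Fin n → Subset n
  image u = tabulate (λ v → ⌊ R? u v ⌋)

  preimage : Fin n → Subset n
  preimage v = tabulate (λ u → ⌊ R? u v ⌋)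

  ∈-image⁺ : ∀ {u v} → R u v → v ∈ image u
  ∈-image⁺ Ruv = ∈-tabulate⁺ (fromWitness Ruv)

  ∈-image⁻ : ∀ {u v} → v ∈ image u → R u v
  ∈-image⁻ v∈ = toWitness (∈-tabulate⁻ v∈)

  ∈-preimage⁻ : ∀ {u v} → u ∈ preimage v → R u v
  ∈-preimage⁻ u∈ = toWitness (∈-tabulate⁻ u∈)

  χ-image≡χ-preimage : ∀ u v → χ (image u) v ≡ χ (preimage v) u
  χ-image≡χ-preimage u v = cong (λ b → if b then 1 else 0)
    (trans (lookup∘tabulate _ v) (sym (lookup∘tabulate (λ w → ⌊ R? w v ⌋) u)))

  double-counting : ∀ {k} → (∀ u → k ≤ ∣ image u ∣) → ∀ U → k * ∣ U ∣ ≤ ∑[ v < n ] ∣ U ∩ preimage v ∣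
  double-counting {k} k≤∣image∣ U = begin
    k * ∣ U ∣                                      ≡⟨ cong (k *_) (∣p∣≡∑χ U) ⟩
    k * ∑[ u < n ] χ U u                           ≡⟨ *-distribˡ-sum k (χ U) ⟩
    ∑[ u < n ] (k * χ U u)                         ≤⟨ ∑-mono-≤ weight ⟩
    ∑[ u < n ] (χ U u * ∣ image u ∣)               ≡⟨ sum-cong-≗ (λ u → cong (χ U u *_) (∣p∣≡∑χ (image u))) ⟩
    ∑[ u < n ] (χ U u * ∑[ v < n ] χ (image u) v)  ≡⟨ sum-cong-≗ (λ u → *-distribˡ-sum (χ U u) (χ (image u))) ⟩
    ∑[ u < n ] ∑[ v < n ] (χ U u * χ (image u) v)  ≡⟨ ∑-comm (λ u v → χ U u * χ (image u) v) ⟩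
    ∑[ v < n ] ∑[ u < n ] (χ U u * χ (image u) v)  ≡⟨ sum-cong-≗ (λ v → sum-cong-≗ (λ u → incidence u v)) ⟩
    ∑[ v < n ] ∑[ u < n ] χ (U ∩ preimage v) u     ≡⟨ sum-cong-≗ (λ v → ∣p∣≡∑χ (U ∩ preimage v)) ⟨
    ∑[ v < n ] ∣ U ∩ preimage v ∣                  ∎
    where
    open ≤-Reasoning
    weight : ∀ u → k * χ U u ≤ χ U u * ∣ image u ∣
    weight u with lookup U u
    ... | true  = subst₂ _≤_ (sym (*-identityʳ k)) (sym (*-identityˡ ∣ image u ∣)) (k≤∣image∣ u)
    ... | false = ≤-reflexive (*-zeroʳ k)
    incidence : ∀ u v → χ U u * χ (image u) v ≡ χ (U ∩ preimage v) u
    incidence u v = trans (cong (χ U u *_) (χ-image≡χ-preimage u v)) (sym (χ-∩ U (preimage v) u))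

module GreedyCover {n} .{{_ : NonZero n}} {R : Fin n → Fin n → Set} (R? : Decidable R) where

  record State : Set where
    field
      chosen  : Subset n
      pending : Subset n
      settled : ∀ u → u ∉ pending → ∃[ v ] (v ∈ chosen × R u v)
  open State

  initial : State
  initial = record { chosen = ⊥ ; pending = ⊤ ; settled = λ u u∉⊤ → contradiction ∈⊤ u∉⊤ }

  best : Subset n → Fin n
  best U = proj₁ (averaging (λ v → ∣ U ∩ preimage R? v ∣))

  step : State → State
  step s = record { chosen = chosen s ∪ ⁅ v ⁆ ; pending = pending s ─ preimage R? v ; settled = settled′ }
    where
    v = best (pending s)
    settled′ : ∀ u → u ∉ pending s ─ preimage R? v → ∃[ w ] (w ∈ chosen s ∪ ⁅ v ⁆ × R u w)
    settled′ u u∉U′ with u ∈? pending s | u ∈? preimage R? v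
    ... | no u∉U  | _       = let w , w∈C , Ruw = settled s u u∉U in w , x∈p∪q⁺ (inj₁ w∈C) , Ruw
    ... | yes _   | yes u∈M = v , x∈p∪q⁺ (inj₂ (x∈⁅x⁆ v)) , ∈-preimage⁻ R? u∈M
    ... | yes u∈U | no u∉M  = contradiction (x∈p∧x∉q⇒x∈p─q u∈U u∉M) u∉U′

  run : ℕ → State → State
  run zero    s = s
  run (suc m) s = run m (step s)

  ∣chosen∣-step : ∀ s → ∣ chosen (step s) ∣ ≤ suc ∣ chosen s ∣
  ∣chosen∣-step s = ≤-trans (∣p∪q∣≤∣p∣+∣q∣ (chosen s) ⁅ v ⁆)
                            (≤-reflexive (trans (cong (∣ chosen s ∣ +_) (∣⁅x⁆∣≡1 v)) (+-comm _ 1)))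
    where v = best (pending s)

  ∣chosen∣-run : ∀ m s → ∣ chosen (run m s) ∣ ≤ m + ∣ chosen s ∣
  ∣chosen∣-run zero    s = ≤-refl
  ∣chosen∣-run (suc m) s = ≤-trans (∣chosen∣-run m (step s))
                                   (≤-trans (+-monoʳ-≤ m (∣chosen∣-step s)) (≤-reflexive (+-suc m _)))

  module _ {k} (k≤∣image∣ : ∀ u → k ≤ ∣ image R? u ∣) where

    best-dominates-many : ∀ U → k * ∣ U ∣ ≤ n * ∣ U ∩ preimage R? (best U) ∣
    best-dominates-many U = ≤-trans (double-counting R? k≤∣image∣ U) (proj₂ (averaging _))

    ∣pending∣-step : ∀ s → n * ∣ pending (step s) ∣ ≤ (n ∸ k) * ∣ pending s ∣
    ∣pending∣-step s = begin
      n * ∣ U ─ M ∣                                  ≡⟨ m+n∸n≡m (n * ∣ U ─ M ∣) (n * ∣ U ∩ M ∣) ⟨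
      n * ∣ U ─ M ∣ + n * ∣ U ∩ M ∣ ∸ n * ∣ U ∩ M ∣ ≡⟨ cong (_∸ n * ∣ U ∩ M ∣) n∣U∣≡n∣U─M∣+n∣U∩M∣ ⟨
      n * ∣ U ∣ ∸ n * ∣ U ∩ M ∣                      ≤⟨ ∸-monoʳ-≤ (n * ∣ U ∣) (best-dominates-many U) ⟩
      n * ∣ U ∣ ∸ k * ∣ U ∣                          ≡⟨ *-distribʳ-∸ ∣ U ∣ n k ⟨
      (n ∸ k) * ∣ U ∣                                ∎
      where
      open ≤-Reasoning
      U = pending s
      M = preimage R? (best U)
      n∣U∣≡n∣U─M∣+n∣U∩M∣ : n * ∣ U ∣ ≡ n * ∣ U ─ M ∣ + n * ∣ U ∩ M ∣
      n∣U∣≡n∣U─M∣+n∣U∩M∣ = trans (cong (n *_) (∣p∣≡∣p─q∣+∣p∩q∣ U M)) (*-distribˡ-+ n _ _)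

    ∣pending∣-run : ∀ m s → n ^ m * ∣ pending (run m s) ∣ ≤ (n ∸ k) ^ m * ∣ pending s ∣
    ∣pending∣-run zero    s = ≤-refl
    ∣pending∣-run (suc m) s = begin
      n * n ^ m * ∣ pending (run m (step s)) ∣   ≡⟨ *-assoc n (n ^ m) _ ⟩
      n * (n ^ m * ∣ pending (run m (step s)) ∣) ≤⟨ *-monoʳ-≤ n (∣pending∣-run m (step s)) ⟩
      n * ((n ∸ k) ^ m * ∣ pending (step s) ∣)   ≡⟨ x∙yz≈y∙xz n ((n ∸ k) ^ m) _ ⟩
      (n ∸ k) ^ m * (n * ∣ pending (step s) ∣)   ≤⟨ *-monoʳ-≤ ((n ∸ k) ^ m) (∣pending∣-step s) ⟩
      (n ∸ k) ^ m * ((n ∸ k) * ∣ pending s ∣)    ≡⟨ x∙yz≈y∙xz ((n ∸ k) ^ m) (n ∸ k) _ ⟩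
      (n ∸ k) * ((n ∸ k) ^ m * ∣ pending s ∣)    ≡⟨ *-assoc (n ∸ k) ((n ∸ k) ^ m) _ ⟨
      (n ∸ k) * (n ∸ k) ^ m * ∣ pending s ∣      ∎
      where open ≤-Reasoning

    ∣pending∣-step-shrinks : 1 ≤ k → ∀ {m} s → ∣ pending s ∣ ≤ suc m → ∣ pending (step s) ∣ ≤ m
    ∣pending∣-step-shrinks 1≤k {m} s ∣U∣≤1+m = shrink (nonempty? (U ∩ M))
      where
      U = pending s
      M = preimage R? (best U)
      shrink : Dec (Nonempty (U ∩ M)) → ∣ U ─ M ∣ ≤ m
      shrink (yes U∩M≢∅) = ≤-pred (≤-trans (p∩q≢∅⇒∣p─q∣<∣p∣ U M U∩M≢∅) ∣U∣≤1+m)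
      shrink (no  U∩M≡∅) = begin
        ∣ U ─ M ∣     ≤⟨ ∣p─q∣≤∣p∣ U M ⟩
        ∣ U ∣         ≤⟨ m≤n*m ∣ U ∣ k {{>-nonZero 1≤k}} ⟩
        k * ∣ U ∣     ≤⟨ best-dominates-many U ⟩
        n * ∣ U ∩ M ∣ ≡⟨ cong (λ p → n * ∣ p ∣) (Empty-unique U∩M≡∅) ⟩
        n * ∣ ⊥ {n} ∣ ≡⟨ cong (n *_) (∣⊥∣≡0 n) ⟩
        n * 0         ≡⟨ *-zeroʳ n ⟩
        0             ≤⟨ z≤n ⟩
        m             ∎
        where open ≤-Reasoning

    ∣pending∣-run-empties : 1 ≤ k → ∀ m s → ∣ pending s ∣ ≤ m → ∣ pending (run m s) ∣ ≡ 0
    ∣pending∣-run-empties 1≤k zero    s ∣U∣≤0   = n≤0⇒n≡0 ∣U∣≤0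
    ∣pending∣-run-empties 1≤k (suc m) s ∣U∣≤1+m =
      ∣pending∣-run-empties 1≤k m (step s) (∣pending∣-step-shrinks 1≤k s ∣U∣≤1+m)

    greedy : 1 ≤ k → ∀ t → ∃[ S ] (Dominating R S × ∃[ r ] (∣ S ∣ ≤ t + r × n ^ t * r ≤ n * (n ∸ k) ^ t))
    greedy 1≤k t = chosen final , dominating , r , size , geometric
      where
      s = run t initial
      r = ∣ pending s ∣
      final = run r s

      dominating : Dominating R (chosen final)
      dominating u = settled final u λ u∈U →
        n≮0 (subst (∣ pending final - u ∣ <_) (∣pending∣-run-empties 1≤k r s ≤-refl) (x∈p⇒∣p-x∣<∣p∣ u∈U))

      size : ∣ chosen final ∣ ≤ t + r
      size = begin
        ∣ chosen final ∣    ≤⟨ ∣chosen∣-run r s ⟩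
        r + ∣ chosen s ∣    ≤⟨ +-monoʳ-≤ r (∣chosen∣-run t initial) ⟩
        r + (t + ∣ ⊥ {n} ∣) ≡⟨ cong (λ c → r + (t + c)) (∣⊥∣≡0 n) ⟩
        r + (t + 0)         ≡⟨ cong (r +_) (+-identityʳ t) ⟩
        r + t               ≡⟨ +-comm r t ⟩
        t + r               ∎
        where open ≤-Reasoning

      geometric : n ^ t * r ≤ n * (n ∸ k) ^ t
      geometric = begin
        n ^ t * r               ≤⟨ ∣pending∣-run t initial ⟩
        (n ∸ k) ^ t * ∣ ⊤ {n} ∣ ≡⟨ cong ((n ∸ k) ^ t *_) (∣⊤∣≡n n) ⟩
        (n ∸ k) ^ t * n         ≡⟨ *-comm _ n ⟩
        n * (n ∸ k) ^ t         ∎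
        where open ≤-Reasoning

    ∃-small-dominating-set : 1 ≤ k → ∃[ S ] (Dominating R S × ExpLeℕ (k * ∣ S ∣ ∸ n) (k ^ n))
    ∃-small-dominating-set 1≤k
      with t , e^[k[t+r]-n]≤k^n ← ∃-rounds n k 1≤k (k≤∣f∣⇒k≤n (image R?) k≤∣image∣)
      with S , dominating , r , ∣S∣≤t+r , remaining ← greedy 1≤k t
      = S , dominating , ExpLeℕ-antimono (∸-monoˡ-≤ n (*-monoʳ-≤ k ∣S∣≤t+r)) (e^[k[t+r]-n]≤k^n r remaining)

-- Restrained hop domination

module _ {n} (G : Graph n) where
  open Graph G using (adj)

  restrained-if-small : ∀ {δ} → IsMinDegree G δ → ∀ S → ∣ S ∣ < δ → Restrained G S
  restrained-if-small (δ≤deg , _) S ∣S∣<δ u _ with any? (λ v → v ∈? tabulate (adj u) ×-dec ¬? (v ∈? S))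
  ... | yes (v , v∈N , v∉S) = v , v∉S , ∈-tabulate⁻ v∈N
  ... | no ∄v = contradiction (p⊆q⇒∣p∣≤∣q∣ N⊆S) (<⇒≱ (<-≤-trans ∣S∣<δ (δ≤deg u)))
    where
    N⊆S : tabulate (adj u) ⊆ S
    N⊆S {v} v∈N = decidable-stable (v ∈? S) (λ v∉S → ∄v (v , v∈N , v∉S))

  SelfOrDist2 : Fin n → Fin n → Set
  SelfOrDist2 u v = u ≡ v ⊎ Dist2 G u v

  selfOrDist2? : ∀ u v → Dec (SelfOrDist2 u v)
  selfOrDist2? u v = u ≟ v ⊎-dec dist2? G u v

  hopDeg<∣selfOrDist2-image∣ : ∀ u → hopDeg G u < ∣ image selfOrDist2? u ∣
  hopDeg<∣selfOrDist2-image∣ u = p⊂q⇒∣p∣<∣q∣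
    ( (λ v∈ → ∈-image⁺ selfOrDist2? (inj₂ (∈-image⁻ (dist2? G) v∈)))
    , u , ∈-image⁺ selfOrDist2? (inj₁ refl) , λ u∈ → proj₁ (∈-image⁻ (dist2? G) u∈) refl )

  Dominating⇒HopDominating : ∀ {S} → Dominating SelfOrDist2 S → HopDominating G S
  Dominating⇒HopDominating dominating u u∉S with dominating u
  ... | v , v∈S , inj₁ refl     = contradiction v∈S u∉S
  ... | v , v∈S , inj₂ d[u,v]≡2 = v , v∈S , d[u,v]≡2

  TRH⇒RH : ∀ {S} → TotalRestrainedHopDominating G S → RestrainedHopDominating G S
  TRH⇒RH (two-step , restrained) = (λ u _ → two-step u) , restrained

  γ-bound : ∀ {P : Subset n → Set} {S s k M g} → P S → ∣ S ∣ ≤ s → ExpLeℕ (k * s ∸ n) M →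
            IsMinCard G P g → ExpLe (g * k ∸ n) M
  γ-bound {S = S} {s} {k} {M} {g} PS ∣S∣≤s e^[ks-n]≤M (_ , minimal) =
    ExpLeℕ⇒ExpLe (ExpLeℕ-antimono (∸-monoˡ-≤ n gk≤ks) e^[ks-n]≤M)
    where
    gk≤ks : g * k ≤ k * s
    gk≤ks = subst (_≤ k * s) (*-comm k g) (*-monoʳ-≤ k (≤-trans (minimal S PS) ∣S∣≤s))

ExpGt-ExpLeℕ⇒< : ∀ n δ k {s} → ExpGt (δ * k ∸ n) (k ^ n) → ExpLeℕ (k * s ∸ n) (k ^ n) → s < δ
ExpGt-ExpLeℕ⇒< n δ k {s} e^[δk-n]>k^n e^[ks-n]≤k^n with s <? δ
... | yes s<δ = s<δ
... | no  s≮δ = ⊥-elim (ExpGt⇒¬ExpLe (δ * k ∸ n) (k ^ n) e^[δk-n]>k^n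
                         (ExpLeℕ⇒ExpLe (ExpLeℕ-antimono (∸-monoˡ-≤ n δk≤ks) e^[ks-n]≤k^n)))
  where
  δk≤ks : δ * k ≤ k * s
  δk≤ks = subst (δ * k ≤_) (*-comm s k) (*-monoˡ-≤ k (≮⇒≥ s≮δ))

module DominationBounds {n} .{{_ : NonZero n}} (G : Graph n) {δ δh}
                        (δ-min : IsMinDegree G δ) (δh-min : IsMinHopDegree G δh) (1≤δh : 1 ≤ δh)
                        (e^[δδh-n]>δh^n : ExpGt (δ * δh ∸ n) (δh ^ n)) where
  open GreedyCover

  ∃-small-trh-set : ∃[ S ] (TotalRestrainedHopDominating G S × ∣ S ∣ < δ × ExpLeℕ (δh * ∣ S ∣ ∸ n) (δh ^ n))
  ∃-small-trh-set
    with S , dominating , e^[δh∣S∣-n]≤δh^n ← ∃-small-dominating-set (dist2? G) (proj₁ δh-min) 1≤δh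
    = S , (dominating , restrained-if-small G δ-min S ∣S∣<δ) , ∣S∣<δ , e^[δh∣S∣-n]≤δh^n
    where
    ∣S∣<δ : ∣ S ∣ < δ
    ∣S∣<δ = ExpGt-ExpLeℕ⇒< n δ δh e^[δδh-n]>δh^n e^[δh∣S∣-n]≤δh^n

  δh+1≤∣selfOrDist2-image∣ : ∀ u → δh + 1 ≤ ∣ image (selfOrDist2? G) u ∣
  δh+1≤∣selfOrDist2-image∣ u = subst (_≤ ∣ image (selfOrDist2? G) u ∣) (+-comm 1 δh)
                                     (≤-<-trans (proj₁ δh-min u) (hopDeg<∣selfOrDist2-image∣ G u))

  ∃-small-rh-set : ∃[ S ] (RestrainedHopDominating G S × ∃[ s ] (∣ S ∣ ≤ s × ExpLeℕ ((δh + 1) * s ∸ n) ((δh + 1) ^ n)))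
  ∃-small-rh-set
    with S , dominating , e^[[δh+1]∣S∣-n]≤[δh+1]^n
           ← ∃-small-dominating-set (selfOrDist2? G) δh+1≤∣selfOrDist2-image∣ (m≤n+m 1 δh)
    with T , trh , ∣T∣<δ , _ ← ∃-small-trh-set
    with ∣ S ∣ <? δ
  ... | yes ∣S∣<δ = S , (Dominating⇒HopDominating G dominating , restrained-if-small G δ-min S ∣S∣<δ) ,
                    ∣ S ∣ , ≤-refl , e^[[δh+1]∣S∣-n]≤[δh+1]^n
  ... | no  ∣S∣≮δ = T , TRH⇒RH G trh , ∣ S ∣ , ≤-trans (<⇒≤ ∣T∣<δ) (≮⇒≥ ∣S∣≮δ) , e^[[δh+1]∣S∣-n]≤[δh+1]^n

  γtrh-bound : ∀ g → IsGammaTRH G g → ExpLe (g * δh ∸ n) (δh ^ n)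
  γtrh-bound g = let S , trh , _ , e^[δh∣S∣-n]≤δh^n = ∃-small-trh-set in γ-bound G trh ≤-refl e^[δh∣S∣-n]≤δh^n

  γrh-bound : ∀ g → IsGammaRH G g → ExpLe (g * (δh + 1) ∸ n) ((δh + 1) ^ n)
  γrh-bound g = let S , rh , s , ∣S∣≤s , e^[[δh+1]s-n]≤[δh+1]^n = ∃-small-rh-set in γ-bound G rh ∣S∣≤s e^[[δh+1]s-n]≤[δh+1]^n

mainTheorem13 :
    ∀ (n : ℕ) (G : Graph n) (δ δh : ℕ) →
    IsMinDegree G δ → IsMinHopDegree G δh →
    1 ≤ δ → 1 ≤ δh →
    -- n < δ δh / (ln δh + 1)   ⇔   δh ^ n < e ^ (δ δh − n)
    ExpGt (δ * δh ∸ n) (δh ^ n) →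
    -- γ_rh ≤ (ln(δh+1)+1) n / (δh+1)   ⇔   e ^ (γ_rh (δh+1) − n) ≤ (δh+1) ^ n
    (∀ g → IsGammaRH G g → ExpLe (g * (δh + 1) ∸ n) ((δh + 1) ^ n))
    ×
    -- γ_trh ≤ (ln δh + 1) n / δh   ⇔   e ^ (γ_trh δh − n) ≤ δh ^ n
    (∀ g → IsGammaTRH G g → ExpLe (g * δh ∸ n) (δh ^ n))
mainTheorem13 zero G δ δh (_ , () , _) _ _ _ _
mainTheorem13 n@(suc _) G δ δh δ-min δh-min _ 1≤δh e^[δδh-n]>δh^n = γrh-bound , γtrh-bound
  where open DominationBounds G δ-min δh-min 1≤δh e^[δδh-n]>δh^n
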